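{- Let $k$ be a positive integer. For $n\ge0$ let $d_k(n)=\sum_{\lambda\vdash n}\#\{s : 1\le s\le t(\lambda),\ h_{s,1}(\lambda)=k\}$ be the total number of first-column hooks of length $k$ over all partitions of $n$. Then $$\sum_{n\ge0} d_k(n)q^n=\frac{q^k}{(q^k;q)_\infty}\sum_{l=1}^k\frac{1}{(q)_{k-l}}.$$
   Context: A partition $\lambda=(\lambda_1,\dots,\lambda_t)$ of $n$ is a nonincreasing sequence of positive integers with sum $n$; $t=t(\lambda)$ is its number of parts. First-column hook lengths: $h_{s,1}(\lambda)=\lambda_s+t-s$ for $1\le s\le t$. Notation: $(a;q)_\infty=\prod_{j\ge0}(1-aq^j)$ and $(q)_m=\prod_{j=1}^m(1-q^j)$. -}

module Defs where

open import Data.Nat as ℕ using (ℕ; zero; suc; _∸_; _≤_)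
open import Data.Integer using (ℤ; +_; -_; _-_) renaming (_+_ to _+ℤ_; _*_ to _*ℤ_)
open import Data.List using (List; []; _∷_; length; map; foldr; upTo; filter; lookup)
open import Data.Nat.ListAction using (sum)
open import Data.List.Relation.Unary.All using (All)
open import Data.List.Relation.Unary.Linked using (Linked)
open import Data.Fin using (Fin; toℕ)
open import Data.Fin.Base using ()
open import Data.List using (allFin)
open import Data.Product using (_×_)
open import Relation.Binary.PropositionalEquality using (_≡_)
open import Relation.Nullary.Decidable using (yes; no)

IsPartition : ℕ → List ℕ → Set
IsPartition n μ = All (1 ≤_) μ × Linked ℕ._≥_ μ × sum μ ≡ n

-- number of s (1 ≤ s ≤ t) with h_{s,1}(μ) = μ_s + t - s = k.
-- Index i : Fin t corresponds to s = i + 1.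
hookCount : ℕ → List ℕ → ℕ
hookCount k μ =
  length (filter (λ i → lookup μ i ℕ.+ (length μ ∸ suc (toℕ i)) ℕ.≟ k) (allFin (length μ)))

Series : Set
Series = ℕ → ℤ

sumTo : ℕ → (ℕ → ℤ) → ℤ
sumTo zero f = f zero
sumTo (suc n) f = sumTo n f +ℤ f (suc n)

oneS : Series
oneS zero = + 1
oneS (suc _) = + 0

monoS : ℕ → Series
monoS m n with m ℕ.≟ n
... | yes _ = + 1
... | no _ = + 0

addS : Series → Series → Series
addS f g n = f n +ℤ g n

mulS : Series → Series → Series
mulS f g n = sumTo n (λ i → f i *ℤ g (n ∸ i))

sumS : List Series → Series
sumS = foldr addS (λ _ → + 0)

prodS : List Series → Series
prodS = foldr mulS oneS

oneMinus : ℕ → Series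
oneMinus m n = oneS n - monoS m n

-- multiplicative inverse of a series with constant term 1:
-- g 0 = 1,  g (n+1) = - Σ_{i=0}^{n} f (i+1) g (n - i)   (fuel-driven recursion)
invFuel : Series → ℕ → Series
invFuel f zero _ = + 1
invFuel f (suc fuel) zero = + 1
invFuel f (suc fuel) (suc n) = - sumTo n (λ i → f (suc i) *ℤ invFuel f fuel (n ∸ i))

invS : Series → Series
invS f n = invFuel f (suc n) n

qPoch : ℕ → Series
qPoch m = prodS (map (λ j → oneMinus (suc j)) (upTo m))

-- (q^k; q)_∞ = ∏_{j≥0} (1 - q^{k+j}); for k ≥ 1 the coefficient of q^n
-- only depends on the factors with j ≤ n, so it is the coefficient of the
-- finite product ∏_{j=0}^{n} (1 - q^{k+j}).
qPochInf : ℕ → Series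
qPochInf k n = prodS (map (λ j → oneMinus (k ℕ.+ j)) (upTo (suc n))) n

rhsSeries : ℕ → Series
rhsSeries k =
  mulS (monoS k)
       (mulS (invS (qPochInf k))
             (sumS (map (λ l → invS (qPoch (k ∸ l))) (map suc (upTo k)))))

module Submission where

-- A partition of n + 1 into t + 1 parts either ends with a part 1 or has all parts at least 2.
-- Deleting that last row, resp. the first column, leaves a partition of n into t parts, resp. of
-- n - t into t + 1 parts, and lowers every remaining first-column hook length by one. This gives
-- recursions in (n, t) for the number p(n,t) of partitions of n into t parts and the number d_k(n,t)
-- of their first-column hooks of length k. The first-column hook lengths are distinct and determine the
-- partition, so adding a row with hook length k matches the partitions of m into u parts without
-- such a hook with the partitions of m + k - u into u + 1 parts with one. Summing over the number
-- of parts gives d_1(m+1) = p(m) and d_{k+1}(m+k+1) + d_k(m) = p(m) + d_k(m+k).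
-- On the other side T_k = (q^k;q)_∞⁻¹ Σ_l (q)_{k-l}⁻¹ satisfies T_1 = P and T_{k+1} = P + (1 - q^k) T_k,
-- where P = (q;q)_∞⁻¹ = Σ p(m) q^m (Euler), because (q^{k+1};q)_∞⁻¹ = (1 - q^k) (q^k;q)_∞⁻¹ and
-- (q^{k+1};q)_∞⁻¹ (q)_k⁻¹ = P. Hence q^k T_k = Σ d_k(n) qⁿ.

open import Defs
open import Data.Product using (_×_; _,_; proj₁; proj₂)
open import Data.Sum using (inj₁; inj₂)
open import Data.Empty using (⊥-elim)
open import Function using (_∘_)
open import Relation.Nullary using (¬_; yes; no; does)
open import Relation.Binary.PropositionalEquality hiding ([_])

module PowerSeries where

  open import Data.Nat as ℕ using (ℕ; zero; suc; _∸_; _≤_; _<_; z≤n; s≤s)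
  import Data.Nat.Properties as ℕ
  open import Data.Integer using (ℤ; +_; -_; _+_; _*_; _-_)
  open import Data.Integer.Properties
    using ( +-assoc; +-comm; +-identityˡ; +-identityʳ; +-inverseˡ; +-commutativeSemigroup
          ; *-assoc; *-comm; *-identityˡ; *-zeroˡ; *-zeroʳ
          ; *-distribˡ-+; *-distribʳ-+; neg-distrib-+; neg-distribˡ-* )
  open import Algebra.Structures using (IsCommutativeMonoid)
  open import Algebra.Bundles using (CommutativeMonoid)
  import Algebra.Properties.CommutativeSemigroup as CommutativeSemigroupProperties
  open CommutativeSemigroupProperties +-commutativeSemigroup using (interchange)
  open import Data.List using (map; upTo; applyUpTo)
  open import Data.List.Properties using (map-∘; map-cong; map-upTo)
  open import Relation.Binary.Bundles using (Setoid)
  import Relation.Binary.Reasoning.Setoid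

  sumTo-cong : ∀ n {f g : ℕ → ℤ} → (∀ i → i ≤ n → f i ≡ g i) → sumTo n f ≡ sumTo n g
  sumTo-cong zero    f≡g = f≡g 0 z≤n
  sumTo-cong (suc n) f≡g =
    cong₂ _+_ (sumTo-cong n (λ i i≤n → f≡g i (ℕ.m≤n⇒m≤1+n i≤n))) (f≡g (suc n) ℕ.≤-refl)

  sumTo-zero : ∀ n {f : ℕ → ℤ} → (∀ i → i ≤ n → f i ≡ + 0) → sumTo n f ≡ + 0
  sumTo-zero n {f} f≡0 = trans (sumTo-cong n f≡0) (zeros n)
    where
    zeros : ∀ n → sumTo n (λ _ → + 0) ≡ + 0
    zeros zero    = refl
    zeros (suc n) = cong (_+ + 0) (zeros n)

  sumTo-distrib-+ : ∀ n (f g : ℕ → ℤ) → sumTo n (λ i → f i + g i) ≡ sumTo n f + sumTo n g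
  sumTo-distrib-+ zero    f g = refl
  sumTo-distrib-+ (suc n) f g =
    trans (cong (_+ (f (suc n) + g (suc n))) (sumTo-distrib-+ n f g))
          (interchange (sumTo n f) (sumTo n g) (f (suc n)) (g (suc n)))

  sumTo-distribˡ-* : ∀ n c (f : ℕ → ℤ) → sumTo n (λ i → c * f i) ≡ c * sumTo n f
  sumTo-distribˡ-* zero    c f = refl
  sumTo-distribˡ-* (suc n) c f =
    trans (cong (_+ c * f (suc n)) (sumTo-distribˡ-* n c f)) (sym (*-distribˡ-+ c (sumTo n f) (f (suc n))))

  sumTo-distribʳ-* : ∀ n c (f : ℕ → ℤ) → sumTo n (λ i → f i * c) ≡ sumTo n f * c
  sumTo-distribʳ-* n c f =
    trans (sumTo-cong n (λ i _ → *-comm (f i) c)) (trans (sumTo-distribˡ-* n c f) (*-comm c (sumTo n f)))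

  sumTo-neg : ∀ n (f : ℕ → ℤ) → sumTo n (λ i → - f i) ≡ - sumTo n f
  sumTo-neg zero    f = refl
  sumTo-neg (suc n) f =
    trans (cong (_+ - f (suc n)) (sumTo-neg n f)) (sym (neg-distrib-+ (sumTo n f) (f (suc n))))

  sumTo-suc : ∀ n (f : ℕ → ℤ) → sumTo (suc n) f ≡ f 0 + sumTo n (f ∘ suc)
  sumTo-suc zero    f = refl
  sumTo-suc (suc n) f = trans (cong (_+ f (suc (suc n))) (sumTo-suc n f)) (+-assoc (f 0) _ _)

  sumTo-reverse : ∀ n (f : ℕ → ℤ) → sumTo n f ≡ sumTo n (λ i → f (n ∸ i))
  sumTo-reverse zero    f = refl
  sumTo-reverse (suc n) f = begin
    sumTo n f + f (suc n)                   ≡⟨ +-comm (sumTo n f) _ ⟩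
    f (suc n) + sumTo n f                   ≡⟨ cong (_+_ (f (suc n))) (sumTo-reverse n f) ⟩
    f (suc n) + sumTo n (λ i → f (n ∸ i))   ≡⟨ sumTo-suc n (λ i → f (suc n ∸ i)) ⟨
    sumTo (suc n) (λ i → f (suc n ∸ i))     ∎
    where open ≡-Reasoning

  sumTo-triangle : ∀ n (F : ℕ → ℕ → ℤ) →
    sumTo n (λ i → sumTo i (F i)) ≡ sumTo n (λ j → sumTo (n ∸ j) (λ i′ → F (j ℕ.+ i′) j))
  sumTo-triangle zero    F = refl
  sumTo-triangle (suc n) F = begin
    sumTo n (λ i → sumTo i (F i)) + (sumTo n (F (suc n)) + F (suc n) (suc n))
      ≡⟨ cong (_+ (sumTo n (F (suc n)) + F (suc n) (suc n))) (sumTo-triangle n F) ⟩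
    columns n + (sumTo n (F (suc n)) + F (suc n) (suc n))
      ≡⟨ +-assoc (columns n) _ _ ⟨
    columns n + sumTo n (F (suc n)) + F (suc n) (suc n)
      ≡⟨ cong₂ _+_ (sumTo-distrib-+ n _ _) (cong (λ i → F i (suc n)) (ℕ.+-identityʳ (suc n))) ⟨
    sumTo n (λ j → column n j + F (suc n) j) + F (suc n ℕ.+ 0) (suc n)
      ≡⟨ cong₂ _+_ (sumTo-cong n (λ j j≤n → sym (column-suc j j≤n)))
                   (cong (λ m → sumTo m (λ i′ → F (suc n ℕ.+ i′) (suc n))) (sym (ℕ.n∸n≡0 n))) ⟩
    columns (suc n) ∎
    where
    open ≡-Reasoning
    column : ℕ → ℕ → ℤ
    column m j = sumTo (m ∸ j) (λ i′ → F (j ℕ.+ i′) j)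
    columns : ℕ → ℤ
    columns m = sumTo m (column m)
    column-suc : ∀ j → j ≤ n → column (suc n) j ≡ column n j + F (suc n) j
    column-suc j j≤n rewrite ℕ.+-∸-assoc 1 j≤n =
      cong (_+_ (column n j)) (cong (λ i → F i j) (trans (ℕ.+-suc j (n ∸ j)) (cong suc (ℕ.m+[n∸m]≡n j≤n))))

  sumTo-extend : ∀ {m n} (f : ℕ → ℤ) → m ≤ n → (∀ i → m < i → f i ≡ + 0) → sumTo n f ≡ sumTo m f
  sumTo-extend {m} f m≤n f≡0 with ℕ.m≤n⇒∃[o]m+o≡n m≤n
  ... | d , refl = extend d
    where
    extend : ∀ d → sumTo (m ℕ.+ d) f ≡ sumTo m f
    extend zero    = cong (λ k → sumTo k f) (ℕ.+-identityʳ m)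
    extend (suc d) rewrite ℕ.+-suc m d =
      trans (cong₂ _+_ (extend d) (f≡0 _ (s≤s (ℕ.m≤m+n m d)))) (+-identityʳ (sumTo m f))

  monoS-≡ : ∀ a → monoS a a ≡ + 1
  monoS-≡ a with a ℕ.≟ a
  ... | yes _  = refl
  ... | no a≢a = ⊥-elim (a≢a refl)

  monoS-≢ : ∀ {a i} → a ≢ i → monoS a i ≡ + 0
  monoS-≢ {a} {i} a≢i with a ℕ.≟ i
  ... | yes a≡i = ⊥-elim (a≢i a≡i)
  ... | no _    = refl

  oneS≗monoS-0 : oneS ≗ monoS 0
  oneS≗monoS-0 zero    = refl
  oneS≗monoS-0 (suc _) = refl

  sumTo-monoS-< : ∀ {n a} (g : ℕ → ℤ) → n < a → sumTo n (λ i → monoS a i * g i) ≡ + 0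
  sumTo-monoS-< {n} g n<a = sumTo-zero n (λ i i≤n →
    trans (cong (_* g i) (monoS-≢ (λ a≡i → ℕ.<⇒≱ n<a (subst (_≤ n) (sym a≡i) i≤n)))) (*-zeroˡ (g i)))

  sumTo-monoS : ∀ n {a} (g : ℕ → ℤ) → a ≤ n → sumTo n (λ i → monoS a i * g i) ≡ g a
  sumTo-monoS zero    g z≤n = trans (cong (_* g 0) (monoS-≡ 0)) (*-identityˡ (g 0))
  sumTo-monoS (suc n) {a} g a≤1+n with ℕ.m≤n⇒m<n∨m≡n a≤1+n
  ... | inj₁ (s≤s a≤n) =
    trans (cong₂ _+_ (sumTo-monoS n g a≤n) (cong (_* g (suc n)) (monoS-≢ (ℕ.<⇒≢ (s≤s a≤n)))))
          (trans (cong (_+_ (g a)) (*-zeroˡ (g (suc n)))) (+-identityʳ (g a)))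
  ... | inj₂ refl =
    trans (cong₂ _+_ (sumTo-monoS-< {n} g ℕ.≤-refl) (cong (_* g (suc n)) (monoS-≡ (suc n))))
          (trans (+-identityˡ _) (*-identityˡ (g (suc n))))

  mulS-cong-≤ : ∀ n {f f′ g g′ : Series} →
    (∀ i → i ≤ n → f i ≡ f′ i) → (∀ i → i ≤ n → g i ≡ g′ i) → mulS f g n ≡ mulS f′ g′ n
  mulS-cong-≤ n f≡f′ g≡g′ =
    sumTo-cong n (λ i i≤n → cong₂ _*_ (f≡f′ i i≤n) (g≡g′ (n ∸ i) (ℕ.m∸n≤m n i)))

  mulS-congʳ-≤ : ∀ n f {g g′} → (∀ i → i ≤ n → g i ≡ g′ i) → mulS f g n ≡ mulS f g′ n
  mulS-congʳ-≤ n f g≡g′ = mulS-cong-≤ n {f = f} {f′ = f} (λ _ _ → refl) g≡g′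

  mulS-cong : ∀ {f f′ g g′} → f ≗ f′ → g ≗ g′ → mulS f g ≗ mulS f′ g′
  mulS-cong f≗f′ g≗g′ n = mulS-cong-≤ n (λ i _ → f≗f′ i) (λ i _ → g≗g′ i)

  mulS-congˡ : ∀ {f f′} g → f ≗ f′ → mulS f g ≗ mulS f′ g
  mulS-congˡ g f≗f′ = mulS-cong {g = g} {g′ = g} f≗f′ (λ _ → refl)

  mulS-congʳ : ∀ f {g g′} → g ≗ g′ → mulS f g ≗ mulS f g′
  mulS-congʳ f g≗g′ = mulS-cong {f = f} {f′ = f} (λ _ → refl) g≗g′

  mulS-monoS-+ : ∀ a m f → mulS (monoS a) f (a ℕ.+ m) ≡ f m
  mulS-monoS-+ a m f =
    trans (sumTo-monoS (a ℕ.+ m) (λ i → f (a ℕ.+ m ∸ i)) (ℕ.m≤m+n a m)) (cong f (ℕ.m+n∸m≡n a m))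

  mulS-monoS-< : ∀ {a n} f → n < a → mulS (monoS a) f n ≡ + 0
  mulS-monoS-< {n = n} f = sumTo-monoS-< (λ i → f (n ∸ i))

  mulS-monoS : ∀ a {f g} → (∀ m → f m ≡ g (a ℕ.+ m)) → (∀ n → n < a → g n ≡ + 0) →
    mulS (monoS a) f ≗ g
  mulS-monoS a {f} {g} f≡g g≡0 n with ℕ.<-≤-connex n a
  ... | inj₁ n<a = trans (mulS-monoS-< f n<a) (sym (g≡0 n n<a))
  ... | inj₂ a≤n rewrite sym (ℕ.m+[n∸m]≡n a≤n) = trans (mulS-monoS-+ a (n ∸ a) f) (f≡g (n ∸ a))

  mulS-identityˡ : ∀ f → mulS oneS f ≗ f
  mulS-identityˡ f n = trans (mulS-congˡ f oneS≗monoS-0 n) (mulS-monoS-+ 0 n f)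

  mulS-comm : ∀ f g → mulS f g ≗ mulS g f
  mulS-comm f g n = trans (sumTo-reverse n _) (sumTo-cong n (λ i i≤n →
    trans (cong (f (n ∸ i) *_) (cong g (ℕ.m∸[m∸n]≡n i≤n))) (*-comm (f (n ∸ i)) (g i))))

  mulS-identityʳ : ∀ f → mulS f oneS ≗ f
  mulS-identityʳ f n = trans (mulS-comm f oneS n) (mulS-identityˡ f n)

  mulS-assoc : ∀ f g h → mulS (mulS f g) h ≗ mulS f (mulS g h)
  mulS-assoc f g h n = begin
    sumTo n (λ i → sumTo i (λ j → f j * g (i ∸ j)) * h (n ∸ i))
      ≡⟨ sumTo-cong n (λ i _ → sym (sumTo-distribʳ-* i (h (n ∸ i)) _)) ⟩
    sumTo n (λ i → sumTo i (λ j → f j * g (i ∸ j) * h (n ∸ i)))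
      ≡⟨ sumTo-triangle n (λ i j → f j * g (i ∸ j) * h (n ∸ i)) ⟩
    sumTo n (λ j → sumTo (n ∸ j) (λ i′ → f j * g (j ℕ.+ i′ ∸ j) * h (n ∸ (j ℕ.+ i′))))
      ≡⟨ sumTo-cong n (λ j _ → trans (sumTo-cong (n ∸ j) (λ i′ _ → regroup j i′))
                                     (sumTo-distribˡ-* (n ∸ j) (f j) _)) ⟩
    sumTo n (λ j → f j * sumTo (n ∸ j) (λ i′ → g i′ * h (n ∸ j ∸ i′))) ∎
    where
    open ≡-Reasoning
    regroup : ∀ j i′ → f j * g (j ℕ.+ i′ ∸ j) * h (n ∸ (j ℕ.+ i′)) ≡ f j * (g i′ * h (n ∸ j ∸ i′))
    regroup j i′ =
      trans (cong₂ (λ a b → f j * g a * h b) (ℕ.m+n∸m≡n j i′) (sym (ℕ.∸-+-assoc n j i′)))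
            (*-assoc (f j) (g i′) (h (n ∸ j ∸ i′)))

  mulS-distribˡ-addS : ∀ f g h → mulS f (addS g h) ≗ addS (mulS f g) (mulS f h)
  mulS-distribˡ-addS f g h n =
    trans (sumTo-cong n (λ i _ → *-distribˡ-+ (f i) (g (n ∸ i)) (h (n ∸ i)))) (sumTo-distrib-+ n _ _)

  mulS-zeroʳ : ∀ f → mulS f (λ _ → + 0) ≗ (λ _ → + 0)
  mulS-zeroʳ f n = sumTo-zero n (λ i _ → *-zeroʳ (f i))

  mulS-oneMinus : ∀ a f n → mulS (oneMinus a) f n ≡ f n - mulS (monoS a) f n
  mulS-oneMinus a f n = begin
    sumTo n (λ i → (oneS i - monoS a i) * f (n ∸ i))
      ≡⟨ sumTo-cong n (λ i _ → distrib i) ⟩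
    sumTo n (λ i → oneS i * f (n ∸ i) - monoS a i * f (n ∸ i))
      ≡⟨ trans (sumTo-distrib-+ n _ _) (cong (_+_ (mulS oneS f n)) (sumTo-neg n _)) ⟩
    mulS oneS f n - mulS (monoS a) f n
      ≡⟨ cong (_- mulS (monoS a) f n) (mulS-identityˡ f n) ⟩
    f n - mulS (monoS a) f n ∎
    where
    open ≡-Reasoning
    distrib : ∀ i → (oneS i - monoS a i) * f (n ∸ i) ≡ oneS i * f (n ∸ i) - monoS a i * f (n ∸ i)
    distrib i = trans (*-distribʳ-+ (f (n ∸ i)) (oneS i) (- monoS a i))
                      (cong (_+_ (oneS i * f (n ∸ i))) (sym (neg-distribˡ-* (monoS a i) (f (n ∸ i)))))

  mulS-isCommutativeMonoid : IsCommutativeMonoid _≗_ mulS oneS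
  mulS-isCommutativeMonoid = record
    { isMonoid = record
      { isSemigroup = record
        { isMagma = record
          { isEquivalence = Setoid.isEquivalence (ℕ →-setoid ℤ)
          ; ∙-cong        = mulS-cong
          }
        ; assoc = mulS-assoc
        }
      ; identity = mulS-identityˡ , mulS-identityʳ
      }
    ; comm = mulS-comm
    }

  mulS-commutativeMonoid : CommutativeMonoid _ _
  mulS-commutativeMonoid = record { isCommutativeMonoid = mulS-isCommutativeMonoid }

  module ≗-Reasoning = Relation.Binary.Reasoning.Setoid (ℕ →-setoid ℤ)
  open CommutativeSemigroupProperties (CommutativeMonoid.commutativeSemigroup mulS-commutativeMonoid) public
    using () renaming (interchange to mulS-interchange; x∙yz≈yx∙z to mulS-x∙yz≈yx∙z)

  invFuel-fuel : ∀ f {fuel fuel′} m → m < fuel → m < fuel′ → invFuel f fuel m ≡ invFuel f fuel′ m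
  invFuel-fuel f {suc _} {suc _} zero    _            _             = refl
  invFuel-fuel f {suc _} {suc _} (suc m) (s≤s m<fuel) (s≤s m<fuel′) = cong -_ (sumTo-cong m (λ i _ →
    cong (f (suc i) *_) (invFuel-fuel f (m ∸ i) (ℕ.≤-<-trans (ℕ.m∸n≤m m i) m<fuel)
                                                (ℕ.≤-<-trans (ℕ.m∸n≤m m i) m<fuel′))))

  invS-inverseʳ : ∀ f → f 0 ≡ + 1 → mulS f (invS f) ≗ oneS
  invS-inverseʳ f f0≡1 zero    = cong (_* + 1) f0≡1
  invS-inverseʳ f f0≡1 (suc m) = begin
    mulS f (invS f) (suc m)
      ≡⟨ sumTo-suc m (λ i → f i * invS f (suc m ∸ i)) ⟩
    f 0 * - rest + sumTo m (λ i → f (suc i) * invS f (m ∸ i))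
      ≡⟨ cong₂ _+_ (trans (cong (_* - rest) f0≡1) (*-identityˡ (- rest)))
                   (sumTo-cong m (λ i i≤m → cong (f (suc i) *_)
                     (invFuel-fuel f (m ∸ i) ℕ.≤-refl (s≤s (ℕ.m∸n≤m m i))))) ⟩
    - rest + rest
      ≡⟨ +-inverseˡ rest ⟩
    + 0 ∎
    where
    open ≡-Reasoning
    rest : ℤ
    rest = sumTo m (λ i → f (suc i) * invFuel f (suc m) (m ∸ i))

  invS-unique : ∀ f g → f 0 ≡ + 1 → mulS f g ≗ oneS → invS f ≗ g
  invS-unique f g f0≡1 fg≗1 = begin
    invS f                    ≈⟨ mulS-identityˡ (invS f) ⟨
    mulS oneS (invS f)        ≈⟨ mulS-congˡ (invS f) (λ n → trans (sym (fg≗1 n)) (mulS-comm f g n)) ⟩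
    mulS (mulS g f) (invS f)  ≈⟨ mulS-assoc g f (invS f) ⟩
    mulS g (mulS f (invS f))  ≈⟨ mulS-congʳ g (invS-inverseʳ f f0≡1) ⟩
    mulS g oneS               ≈⟨ mulS-identityʳ g ⟩
    g                         ∎
    where open ≗-Reasoning

  invS-cong : ∀ {f g} → f ≗ g → invS f ≗ invS g
  invS-cong {f} {g} f≗g n = fuel (suc n) n
    where
    fuel : ∀ k m → invFuel f k m ≡ invFuel g k m
    fuel zero    _       = refl
    fuel (suc k) zero    = refl
    fuel (suc k) (suc m) = cong -_ (sumTo-cong m (λ i _ → cong₂ _*_ (f≗g (suc i)) (fuel k (m ∸ i))))

  invS-mulS : ∀ f g → f 0 ≡ + 1 → g 0 ≡ + 1 → invS (mulS f g) ≗ mulS (invS f) (invS g)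
  invS-mulS f g f0≡1 g0≡1 = invS-unique (mulS f g) (mulS (invS f) (invS g)) (cong₂ _*_ f0≡1 g0≡1) (begin
    mulS (mulS f g) (mulS (invS f) (invS g))  ≈⟨ mulS-interchange f g (invS f) (invS g) ⟩
    mulS (mulS f (invS f)) (mulS g (invS g))  ≈⟨ mulS-cong (invS-inverseʳ f f0≡1) (invS-inverseʳ g g0≡1) ⟩
    mulS oneS oneS                            ≈⟨ mulS-identityˡ oneS ⟩
    oneS                                      ∎)
    where open ≗-Reasoning

  -- pochhammer a m = (q^a; q)_m; definitionally qPoch m = pochhammer 1 m and qPochInf a n = pochhammer a (1 + n) n.
  pochhammer : ℕ → ℕ → Series
  pochhammer a m = prodS (map (λ j → oneMinus (a ℕ.+ j)) (upTo m))

  pochhammer-suc : ∀ a m → pochhammer a (suc m) ≡ mulS (oneMinus a) (pochhammer (suc a) m)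
  pochhammer-suc a m = cong₂ mulS (cong oneMinus (ℕ.+-identityʳ a)) (cong prodS (begin
    map factor (applyUpTo suc m)                  ≡⟨ cong (map factor) (map-upTo suc m) ⟨
    map factor (map suc (upTo m))                 ≡⟨ map-∘ (upTo m) ⟨
    map (factor ∘ suc) (upTo m)                   ≡⟨ map-cong (λ j → cong oneMinus (ℕ.+-suc a j)) (upTo m) ⟩
    map (λ j → oneMinus (suc a ℕ.+ j)) (upTo m)   ∎))
    where
    open ≡-Reasoning
    factor : ℕ → Series
    factor j = oneMinus (a ℕ.+ j)

  pochhammer-+ : ∀ k a m → pochhammer a (k ℕ.+ m) ≗ mulS (pochhammer a k) (pochhammer (a ℕ.+ k) m)
  pochhammer-+ zero    a m n =
    sym (trans (mulS-identityˡ (pochhammer (a ℕ.+ 0) m) n) (cong (λ b → pochhammer b m n) (ℕ.+-identityʳ a)))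
  pochhammer-+ (suc k) a m = begin
    pochhammer a (suc k ℕ.+ m)
      ≡⟨ pochhammer-suc a (k ℕ.+ m) ⟩
    mulS (oneMinus a) (pochhammer (suc a) (k ℕ.+ m))
      ≈⟨ mulS-congʳ (oneMinus a) (pochhammer-+ k (suc a) m) ⟩
    mulS (oneMinus a) (mulS (pochhammer (suc a) k) (pochhammer (suc a ℕ.+ k) m))
      ≈⟨ mulS-assoc (oneMinus a) (pochhammer (suc a) k) (pochhammer (suc a ℕ.+ k) m) ⟨
    mulS (mulS (oneMinus a) (pochhammer (suc a) k)) (pochhammer (suc a ℕ.+ k) m)
      ≡⟨ cong₂ (λ p b → mulS p (pochhammer b m)) (sym (pochhammer-suc a k)) (sym (ℕ.+-suc a k)) ⟩
    mulS (pochhammer a (suc k)) (pochhammer (a ℕ.+ suc k) m) ∎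
    where open ≗-Reasoning

  pochhammer-stable : ∀ m a i → i < a ℕ.+ m → pochhammer a (suc m) i ≡ pochhammer a m i
  pochhammer-stable zero a i i<a+0 = begin
    pochhammer a 1 i            ≡⟨ cong (λ p → p i) (pochhammer-suc a 0) ⟩
    mulS (oneMinus a) oneS i    ≡⟨ mulS-identityʳ (oneMinus a) i ⟩
    oneS i - monoS a i          ≡⟨ cong (λ c → oneS i - c) (monoS-≢ (λ a≡i → ℕ.<-irrefl (sym a≡i) i<a)) ⟩
    oneS i - + 0                ≡⟨ +-identityʳ (oneS i) ⟩
    oneS i                      ∎
    where
    open ≡-Reasoning
    i<a : i < a
    i<a = subst (i <_) (ℕ.+-identityʳ a) i<a+0
  pochhammer-stable (suc m) a i i<a+1+m = begin
    pochhammer a (suc (suc m)) i                    ≡⟨ cong (λ p → p i) (pochhammer-suc a (suc m)) ⟩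
    mulS (oneMinus a) (pochhammer (suc a) (suc m)) i
      ≡⟨ mulS-congʳ-≤ i (oneMinus a) (λ j j≤i → pochhammer-stable m (suc a) j
           (ℕ.≤-<-trans j≤i (subst (i <_) (ℕ.+-suc a m) i<a+1+m))) ⟩
    mulS (oneMinus a) (pochhammer (suc a) m) i      ≡⟨ cong (λ p → p i) (pochhammer-suc a m) ⟨
    pochhammer a (suc m) i                          ∎
    where open ≡-Reasoning

  pochhammer-stable-≤ : ∀ a m m′ i → i < a ℕ.+ m → m ≤ m′ → pochhammer a m′ i ≡ pochhammer a m i
  pochhammer-stable-≤ a m m′ i i<a+m m≤m′ with ℕ.m≤n⇒∃[o]m+o≡n m≤m′
  ... | d , refl = stable d
    where
    stable : ∀ d → pochhammer a (m ℕ.+ d) i ≡ pochhammer a m i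
    stable zero    = cong (λ k → pochhammer a k i) (ℕ.+-identityʳ m)
    stable (suc d) rewrite ℕ.+-suc m d = trans
      (pochhammer-stable (m ℕ.+ d) a i (ℕ.<-≤-trans i<a+m (ℕ.+-monoʳ-≤ a (ℕ.m≤m+n m d)))) (stable d)

  qPochInf≡pochhammer : ∀ a m i → i < a ℕ.+ m → qPochInf a i ≡ pochhammer a m i
  qPochInf≡pochhammer a m i i<a+m with ℕ.≤-total m (suc i)
  ... | inj₁ m≤1+i = pochhammer-stable-≤ a m (suc i) i i<a+m m≤1+i
  ... | inj₂ 1+i≤m = sym (pochhammer-stable-≤ a (suc i) m i (ℕ.m≤n+m (suc i) a) 1+i≤m)

  qPochInf-0 : ∀ a → 1 ≤ a → qPochInf a 0 ≡ + 1
  qPochInf-0 a 1≤a = qPochInf≡pochhammer a 0 0 (subst (0 <_) (sym (ℕ.+-identityʳ a)) 1≤a)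

  qPoch-0 : ∀ m → qPoch m 0 ≡ + 1
  qPoch-0 m = pochhammer-stable-≤ 1 0 m 0 (s≤s z≤n) z≤n

  qPochInf-suc : ∀ a → qPochInf a ≗ mulS (oneMinus a) (qPochInf (suc a))
  qPochInf-suc a n = begin
    qPochInf a n                                      ≡⟨ pochhammer-stable (suc n) a n (ℕ.m≤n+m (suc n) a) ⟨
    pochhammer a (suc (suc n)) n                      ≡⟨ cong (λ p → p n) (pochhammer-suc a (suc n)) ⟩
    mulS (oneMinus a) (pochhammer (suc a) (suc n)) n
      ≡⟨ mulS-congʳ-≤ n (oneMinus a) (λ i i≤n → sym (qPochInf≡pochhammer (suc a) (suc n) i (below i≤n))) ⟩
    mulS (oneMinus a) (qPochInf (suc a)) n            ∎
    where
    open ≡-Reasoning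
    below : ∀ {i} → i ≤ n → i < suc a ℕ.+ suc n
    below i≤n = ℕ.≤-trans (s≤s i≤n) (ℕ.m≤n+m (suc n) (suc a))

  qPochInf-1 : ∀ k → qPochInf 1 ≗ mulS (qPoch k) (qPochInf (suc k))
  qPochInf-1 k n = begin
    qPochInf 1 n                                  ≡⟨ qPochInf≡pochhammer 1 (k ℕ.+ suc n) n (below ℕ.≤-refl) ⟩
    pochhammer 1 (k ℕ.+ suc n) n                  ≡⟨ pochhammer-+ k 1 (suc n) n ⟩
    mulS (qPoch k) (pochhammer (suc k) (suc n)) n
      ≡⟨ mulS-congʳ-≤ n (qPoch k) (λ i i≤n → sym (qPochInf≡pochhammer (suc k) (suc n) i (below i≤n))) ⟩
    mulS (qPoch k) (qPochInf (suc k)) n           ∎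
    where
    open ≡-Reasoning
    below : ∀ {i} → i ≤ n → i < suc k ℕ.+ suc n
    below i≤n = ℕ.≤-trans (s≤s i≤n) (ℕ.m≤n+m (suc n) (suc k))

  qPoch-suc : ∀ b → qPoch (suc b) ≗ mulS (qPoch b) (oneMinus (suc b))
  qPoch-suc b n = begin
    qPoch (suc b) n                           ≡⟨ cong (λ k → pochhammer 1 k n) (ℕ.+-comm 1 b) ⟩
    pochhammer 1 (b ℕ.+ 1) n                  ≡⟨ pochhammer-+ b 1 1 n ⟩
    mulS (qPoch b) (pochhammer (suc b) 1) n
      ≡⟨ mulS-congʳ-≤ n (qPoch b) (λ i _ → trans (cong (λ p → p i) (pochhammer-suc (suc b) 0))
                                                 (mulS-identityʳ (oneMinus (suc b)) i)) ⟩
    mulS (qPoch b) (oneMinus (suc b)) n       ∎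
    where open ≡-Reasoning

module Partitions where

  open import Data.Nat using (ℕ; zero; suc; _+_; _∸_; _≤_; _<_; _≥_; z≤n; s≤s; _≟_; _≡ᵇ_; pred)
  import Data.Nat.Properties as ℕ
  import Algebra.Properties.CommutativeSemigroup as CommutativeSemigroupProperties
  open CommutativeSemigroupProperties ℕ.+-commutativeSemigroup using (x∙yz≈y∙xz; interchange)
  open import Data.Bool using (true; false)
  open import Data.Fin using (Fin; toℕ)
  open import Data.List using (List; []; _∷_; [_]; _++_; _∷ʳ_; length; map; filter; lookup; tabulate; allFin)
  open import Data.List.Properties
    using (length-++; length-map; map-tabulate; filter-++; map-∘; map-cong; map-cong-local; map-id; map-id-local)
  open import Data.List.Relation.Unary.All as All using (All; []; _∷_; all?)
  import Data.List.Relation.Unary.All.Properties as Allₚ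
  open import Data.List.Relation.Unary.Any using (here; there)
  open import Data.List.Relation.Unary.Linked as Linked using (Linked; []; [-]; _∷_)
  import Data.List.Relation.Unary.Linked.Properties as Linkedₚ
  open import Data.List.Relation.Unary.AllPairs using (_∷_)
  open import Data.List.Relation.Unary.Unique.Propositional using (Unique)
  import Data.List.Relation.Unary.Unique.Propositional.Properties as Unique
  open import Data.List.Membership.Propositional using (_∈_)
  open import Data.List.Membership.Propositional.Properties using (∈-map⁺; ∈-map⁻; ∈-filter⁺; ∈-filter⁻)
  open import Data.Nat.ListAction using (sum)
  open import Data.Nat.ListAction.Properties using (sum-++)
  open import Function.Bundles using (_⇔_; mk⇔; Equivalence)
  open import Relation.Unary using (Pred; Decidable; ∁)
  open import Relation.Unary.Properties using (∁?)

  length-∷ʳ : ∀ {A : Set} (xs : List A) x → length (xs ∷ʳ x) ≡ suc (length xs)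
  length-∷ʳ xs x = trans (length-++ xs) (ℕ.+-comm (length xs) 1)

  length-filter-map : ∀ {A B : Set} {p} {P : Pred B p} (P? : Decidable P) (f : A → B) xs →
    length (filter (P? ∘ f) xs) ≡ length (filter P? (map f xs))
  length-filter-map P? f []       = refl
  length-filter-map P? f (x ∷ xs) with does (P? (f x))
  ... | true  = cong suc (length-filter-map P? f xs)
  ... | false = length-filter-map P? f xs

  sum-map-filter : ∀ {A : Set} {Q : A → Set} (Q? : Decidable Q) (h : A → ℕ) xs →
    sum (map h xs) ≡ sum (map h (filter (∁? Q?) xs)) + sum (map h (filter Q? xs))
  sum-map-filter Q? h []       = refl
  sum-map-filter Q? h (x ∷ xs) with does (Q? x)
  ... | true  = trans (cong (h x +_) (sum-map-filter Q? h xs))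
                      (x∙yz≈y∙xz (h x) (sum (map h (filter (∁? Q?) xs))) (sum (map h (filter Q? xs))))
  ... | false = trans (cong (h x +_) (sum-map-filter Q? h xs)) (sym (ℕ.+-assoc (h x) _ _))

  sum-map-const-1 : ∀ {A : Set} (xs : List A) → sum (map (λ _ → 1) xs) ≡ length xs
  sum-map-const-1 []       = refl
  sum-map-const-1 (_ ∷ xs) = cong suc (sum-map-const-1 xs)

  sum-map-cong-∈ : ∀ {A : Set} {f g : A → ℕ} {xs} →
    (∀ {x} → x ∈ xs → f x ≡ g x) → sum (map f xs) ≡ sum (map g xs)
  sum-map-cong-∈ f≡g = cong sum (map-cong-local (All.tabulate f≡g))

  multiplicity : ℕ → List ℕ → ℕ
  multiplicity k xs = length (filter (_≟ k) xs)

  multiplicity-map-suc : ∀ k xs → multiplicity (suc k) (map suc xs) ≡ multiplicity k xs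
  multiplicity-map-suc k []       = refl
  multiplicity-map-suc k (x ∷ xs) with x ≡ᵇ k
  ... | true  = cong suc (multiplicity-map-suc k xs)
  ... | false = multiplicity-map-suc k xs

  multiplicity-++ : ∀ k xs ys → multiplicity k (xs ++ ys) ≡ multiplicity k xs + multiplicity k ys
  multiplicity-++ k xs ys = trans (cong length (filter-++ (_≟ k) xs ys)) (length-++ (filter (_≟ k) xs))

  multiplicity-0 : ∀ {xs} → All (1 ≤_) xs → multiplicity 0 xs ≡ 0
  multiplicity-0 []               = refl
  multiplicity-0 (s≤s z≤n ∷ 1≤xs) = multiplicity-0 1≤xs

  -- The first-column hook lengths λ_s + t - s, top row first.
  hooks : List ℕ → List ℕ
  hooks []       = []
  hooks (x ∷ xs) = x + length xs ∷ hooks xs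

  hooks-tabulate : ∀ μ → tabulate (λ i → lookup μ i + (length μ ∸ suc (toℕ i))) ≡ hooks μ
  hooks-tabulate []       = refl
  hooks-tabulate (x ∷ xs) = cong (x + length xs ∷_) (hooks-tabulate xs)

  hookCount≡multiplicity : ∀ k μ → hookCount k μ ≡ multiplicity k (hooks μ)
  hookCount≡multiplicity k μ = begin
    length (filter ((_≟ k) ∘ hook) (allFin (length μ)))
      ≡⟨ length-filter-map (_≟ k) hook (allFin (length μ)) ⟩
    multiplicity k (map hook (allFin (length μ)))
      ≡⟨ cong (multiplicity k) (trans (map-tabulate (λ i → i) hook) (hooks-tabulate μ)) ⟩
    multiplicity k (hooks μ) ∎
    where
    open ≡-Reasoning
    hook : Fin (length μ) → ℕ
    hook i = lookup μ i + (length μ ∸ suc (toℕ i))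

  hooks-positive : ∀ {μ} → All (1 ≤_) μ → All (1 ≤_) (hooks μ)
  hooks-positive []                    = []
  hooks-positive {x ∷ xs} (1≤x ∷ 1≤xs) = ℕ.≤-trans 1≤x (ℕ.m≤m+n x (length xs)) ∷ hooks-positive 1≤xs

  hooks-map-suc : ∀ ν → hooks (map suc ν) ≡ map suc (hooks ν)
  hooks-map-suc []      = refl
  hooks-map-suc (x ∷ ν) = cong₂ _∷_ (cong (suc x +_) (length-map suc ν)) (hooks-map-suc ν)

  hooks-∷ʳ-1 : ∀ ν → hooks (ν ∷ʳ 1) ≡ map suc (hooks ν) ∷ʳ 1
  hooks-∷ʳ-1 []      = refl
  hooks-∷ʳ-1 (x ∷ ν) =
    cong₂ _∷_ (trans (cong (x +_) (length-∷ʳ ν 1)) (ℕ.+-suc x (length ν))) (hooks-∷ʳ-1 ν)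

  hookCount-map-suc : ∀ k ν → hookCount (suc k) (map suc ν) ≡ hookCount k ν
  hookCount-map-suc k ν = begin
    hookCount (suc k) (map suc ν)              ≡⟨ hookCount≡multiplicity (suc k) (map suc ν) ⟩
    multiplicity (suc k) (hooks (map suc ν))   ≡⟨ cong (multiplicity (suc k)) (hooks-map-suc ν) ⟩
    multiplicity (suc k) (map suc (hooks ν))   ≡⟨ multiplicity-map-suc k (hooks ν) ⟩
    multiplicity k (hooks ν)                   ≡⟨ hookCount≡multiplicity k ν ⟨
    hookCount k ν                              ∎
    where open ≡-Reasoning

  hookCount-∷ʳ-1 : ∀ k ν → hookCount (suc k) (ν ∷ʳ 1) ≡ hookCount k ν + multiplicity k [ 0 ]
  hookCount-∷ʳ-1 k ν = begin
    hookCount (suc k) (ν ∷ʳ 1)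
      ≡⟨ trans (hookCount≡multiplicity (suc k) (ν ∷ʳ 1)) (cong (multiplicity (suc k)) (hooks-∷ʳ-1 ν)) ⟩
    multiplicity (suc k) (map suc (hooks ν) ∷ʳ 1)
      ≡⟨ multiplicity-++ (suc k) (map suc (hooks ν)) [ 1 ] ⟩
    multiplicity (suc k) (map suc (hooks ν)) + multiplicity (suc k) [ 1 ]
      ≡⟨ cong₂ _+_ (trans (multiplicity-map-suc k (hooks ν)) (sym (hookCount≡multiplicity k ν)))
                   (multiplicity-map-suc k [ 0 ]) ⟩
    hookCount k ν + multiplicity k [ 0 ] ∎
    where open ≡-Reasoning

  hookCount-0 : ∀ {ν} → All (1 ≤_) ν → hookCount 0 ν ≡ 0
  hookCount-0 {ν} 1≤ν = trans (hookCount≡multiplicity 0 ν) (multiplicity-0 (hooks-positive 1≤ν))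

  Enumerates : {A : Set} → List A → (A → Set) → Set
  Enumerates L P = Unique L × (∀ x → x ∈ L ⇔ P x)

  enumerates-filter : ∀ {A : Set} {P Q : A → Set} (Q? : Decidable Q) {L} →
    Enumerates L P → Enumerates (filter Q? L) (λ x → P x × Q x)
  enumerates-filter Q? (unique , mem) = Unique.filter⁺ Q? unique , λ x → mk⇔
    (λ x∈ → let x∈L , Qx = ∈-filter⁻ Q? x∈ in Equivalence.to (mem x) x∈L , Qx)
    (λ (Px , Qx) → ∈-filter⁺ Q? (Equivalence.from (mem x) Px) Qx)

  enumerates-∅ : ∀ {A : Set} {P : A → Set} {L} → Enumerates L P → (∀ x → ¬ P x) → L ≡ []
  enumerates-∅ {L = []}    _         _  = refl
  enumerates-∅ {L = x ∷ _} (_ , mem) ¬P = ⊥-elim (¬P x (Equivalence.to (mem x) (here refl)))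

  enumerates-singleton : ∀ {A : Set} {a : A} {L} → Enumerates L (_≡ a) → L ≡ [ a ]
  enumerates-singleton {a = a} {[]} (_ , mem) with () ← Equivalence.from (mem a) refl
  enumerates-singleton {L = x ∷ []}    (_ , mem) = cong [_] (Equivalence.to (mem x) (here refl))
  enumerates-singleton {L = x ∷ y ∷ _} ((x≢y ∷ _) ∷ _ , mem) =
    ⊥-elim (x≢y (trans (Equivalence.to (mem x) (here refl)) (sym (Equivalence.to (mem y) (there (here refl))))))

  record Correspondence {A B : Set} (P : A → Set) (Q : B → Set) : Set where
    field
      to      : A → B
      from    : B → A
      to-Q    : ∀ {x} → P x → Q (to x)
      from-P  : ∀ {y} → Q y → P (from y)
      from∘to : ∀ {x} → P x → from (to x) ≡ x
      to∘from : ∀ {y} → Q y → to (from y) ≡ y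

  module _ {A B : Set} {P : A → Set} {Q : B → Set} (c : Correspondence P Q) {L} (enum : Enumerates L P) where
    open Correspondence c

    private
      P-∈ : ∀ {x} → x ∈ L → P x
      P-∈ {x} = Equivalence.to (proj₂ enum x)

    map-from∘to : map from (map to L) ≡ L
    map-from∘to = trans (sym (map-∘ L)) (map-id-local (All.tabulate (from∘to ∘ P-∈)))

    enumerates-map : Enumerates (map to L) Q
    enumerates-map = Unique.map⁻ (subst Unique (sym map-from∘to) (proj₁ enum)) , λ y → mk⇔
      (λ y∈ → let x , x∈L , y≡to-x = ∈-map⁻ to y∈ in subst Q (sym y≡to-x) (to-Q (P-∈ x∈L)))
      (λ Qy → subst (_∈ map to L) (to∘from Qy) (∈-map⁺ to (Equivalence.from (proj₂ enum (from y)) (from-P Qy))))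

    sum-map-transport : ∀ h → sum (map h L) ≡ sum (map (h ∘ from) (map to L))
    sum-map-transport h = trans (cong (sum ∘ map h) (sym map-from∘to)) (cong sum (sym (map-∘ (map to L))))

  IsPartitionInto : ℕ → ℕ → List ℕ → Set
  IsPartitionInto n t μ = IsPartition n μ × length μ ≡ t

  length≤sum : ∀ {μ} → All (1 ≤_) μ → length μ ≤ sum μ
  length≤sum []          = z≤n
  length≤sum (1≤x ∷ 1≤μ) = ℕ.+-mono-≤ 1≤x (length≤sum 1≤μ)

  parts≤size : ∀ {n t μ} → IsPartitionInto n t μ → t ≤ n
  parts≤size ((1≤μ , _ , refl) , refl) = length≤sum 1≤μ

  dropLast : {A : Set} → List A → List A
  dropLast []           = []
  dropLast (_ ∷ [])     = []
  dropLast (x ∷ y ∷ ys) = x ∷ dropLast (y ∷ ys)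

  dropLast-∷ʳ : ∀ {A : Set} (xs : List A) x → dropLast (xs ∷ʳ x) ≡ xs
  dropLast-∷ʳ []           x = refl
  dropLast-∷ʳ (y ∷ [])     x = refl
  dropLast-∷ʳ (y ∷ z ∷ zs) x = cong (y ∷_) (dropLast-∷ʳ (z ∷ zs) x)

  dropLast-∷ʳ-1 : ∀ {μ} → All (1 ≤_) μ → Linked _≥_ μ → ¬ All (2 ≤_) μ → dropLast μ ∷ʳ 1 ≡ μ
  dropLast-∷ʳ-1 {[]}        _             _           ¬2≤ = ⊥-elim (¬2≤ [])
  dropLast-∷ʳ-1 {x ∷ []}    (1≤x ∷ [])    _           ¬2≤ =
    cong [_] (ℕ.≤-antisym 1≤x (ℕ.≮⇒≥ (λ 1<x → ¬2≤ (1<x ∷ []))))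
  dropLast-∷ʳ-1 {x ∷ y ∷ μ} (_ ∷ 1≤y∷μ) (y≤x ∷ sorted) ¬2≤ =
    cong (x ∷_) (dropLast-∷ʳ-1 1≤y∷μ sorted (λ { 2≤y∷μ@(2≤y ∷ _) → ¬2≤ (ℕ.≤-trans 2≤y y≤x ∷ 2≤y∷μ) }))

  Linked-∷ʳ⁻ : ∀ {A : Set} {R : A → A → Set} xs {x} → Linked R (xs ∷ʳ x) → Linked R xs
  Linked-∷ʳ⁻ []           _        = []
  Linked-∷ʳ⁻ (_ ∷ [])     _        = [-]
  Linked-∷ʳ⁻ (_ ∷ y ∷ ys) (r ∷ rs) = r ∷ Linked-∷ʳ⁻ (y ∷ ys) rs

  Linked-∷ʳ⁺ : ∀ {A : Set} {R : A → A → Set} {xs x} →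
    Linked R xs → All (λ y → R y x) xs → Linked R (xs ∷ʳ x)
  Linked-∷ʳ⁺ []       []        = [-]
  Linked-∷ʳ⁺ [-]      (r ∷ [])  = r ∷ [-]
  Linked-∷ʳ⁺ (r ∷ rs) (_ ∷ rs′) = r ∷ Linked-∷ʳ⁺ rs rs′

  sum-∷ʳ-1 : ∀ ν → sum (ν ∷ʳ 1) ≡ suc (sum ν)
  sum-∷ʳ-1 ν = trans (sum-++ ν [ 1 ]) (ℕ.+-comm (sum ν) 1)

  sum-map-suc : ∀ ν → sum (map suc ν) ≡ sum ν + length ν
  sum-map-suc []      = refl
  sum-map-suc (x ∷ ν) = trans (cong (suc x +_) (sum-map-suc ν))
    (trans (cong suc (sym (ℕ.+-assoc x (sum ν) (length ν)))) (sym (ℕ.+-suc (x + sum ν) (length ν))))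

  lastRow : ∀ n t →
    Correspondence (λ μ → IsPartitionInto (suc n) (suc t) μ × ∁ (All (2 ≤_)) μ) (IsPartitionInto n t)
  lastRow n t = record
    { to      = dropLast
    ; from    = _∷ʳ 1
    ; to-Q    = to-Q
    ; from-P  = from-P
    ; from∘to = λ (((1≤μ , sorted , _) , _) , ¬2≤) → dropLast-∷ʳ-1 1≤μ sorted ¬2≤
    ; to∘from = λ {ν} _ → dropLast-∷ʳ ν 1
    }
    where
    without-last : ∀ {ν} → IsPartitionInto (suc n) (suc t) (ν ∷ʳ 1) → IsPartitionInto n t ν
    without-last {ν} ((1≤ν , sorted , size) , len) =
      (proj₁ (Allₚ.∷ʳ⁻ 1≤ν) , Linked-∷ʳ⁻ ν sorted , ℕ.suc-injective (trans (sym (sum-∷ʳ-1 ν)) size)) ,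
      ℕ.suc-injective (trans (sym (length-∷ʳ ν 1)) len)
    to-Q : ∀ {μ} → IsPartitionInto (suc n) (suc t) μ × ¬ All (2 ≤_) μ → IsPartitionInto n t (dropLast μ)
    to-Q (μ-part@((1≤μ , sorted , _) , _) , ¬2≤) =
      without-last (subst (IsPartitionInto (suc n) (suc t)) (sym (dropLast-∷ʳ-1 1≤μ sorted ¬2≤)) μ-part)
    from-P : ∀ {ν} → IsPartitionInto n t ν →
      IsPartitionInto (suc n) (suc t) (ν ∷ʳ 1) × ¬ All (2 ≤_) (ν ∷ʳ 1)
    from-P {ν} ((1≤ν , sorted , refl) , refl) =
      ((Allₚ.∷ʳ⁺ 1≤ν (s≤s z≤n) , Linked-∷ʳ⁺ sorted 1≤ν , sum-∷ʳ-1 ν) , length-∷ʳ ν 1) ,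
      λ 2≤ → ℕ.<-irrefl refl (proj₂ (Allₚ.∷ʳ⁻ 2≤))

  firstColumn : ∀ n t →
    Correspondence (λ μ → IsPartitionInto (suc n) (suc t) μ × All (2 ≤_) μ) (IsPartitionInto (n ∸ t) (suc t))
  firstColumn n t = record
    { to      = map pred
    ; from    = map suc
    ; to-Q    = to-Q
    ; from-P  = from-P
    ; from∘to = λ (((1≤μ , _) , _) , _) → suc∘pred 1≤μ
    ; to∘from = λ {ν} _ → trans (sym (map-∘ ν)) (map-id ν)
    }
    where
    suc∘pred : ∀ {μ} → All (1 ≤_) μ → map suc (map pred μ) ≡ μ
    suc∘pred {μ} 1≤μ = trans (sym (map-∘ μ)) (map-id-local (All.map (λ { (s≤s _) → refl }) 1≤μ))
    to-Q : ∀ {μ} → IsPartitionInto (suc n) (suc t) μ × All (2 ≤_) μ →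
      IsPartitionInto (n ∸ t) (suc t) (map pred μ)
    to-Q {μ} (((1≤μ , sorted , size) , len) , 2≤μ) =
      (Allₚ.map⁺ (All.map ℕ.pred-mono-≤ 2≤μ) , Linkedₚ.map⁺ (Linked.map ℕ.pred-mono-≤ sorted) , size′) ,
      trans (length-map pred μ) len
      where
      s : ℕ
      s = sum (map pred μ)
      size′ : s ≡ n ∸ t
      size′ = begin
        s                                         ≡⟨ ℕ.m+n∸n≡m s (length μ) ⟨
        s + length μ ∸ length μ                   ≡⟨ cong (λ l → s + l ∸ length μ) (length-map pred μ) ⟨
        s + length (map pred μ) ∸ length μ        ≡⟨ cong (_∸ length μ) (sum-map-suc (map pred μ)) ⟨
        sum (map suc (map pred μ)) ∸ length μ     ≡⟨ cong₂ _∸_ (trans (cong sum (suc∘pred 1≤μ)) size) len ⟩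
        suc n ∸ suc t                             ∎
        where open ≡-Reasoning
    from-P : ∀ {ν} → IsPartitionInto (n ∸ t) (suc t) ν →
      IsPartitionInto (suc n) (suc t) (map suc ν) × All (2 ≤_) (map suc ν)
    from-P {ν} ν-part@((1≤ν , sorted , size) , len) =
      ( ( Allₚ.map⁺ (All.map (λ _ → s≤s z≤n) 1≤ν) , Linkedₚ.map⁺ (Linked.map s≤s sorted) , size′)
      , trans (length-map suc ν) len) ,
      Allₚ.map⁺ (All.map s≤s 1≤ν)
      where
      t≤n : t ≤ n
      t≤n = ℕ.≮⇒≥ (λ n<t → ℕ.<⇒≱ (s≤s z≤n)
        (ℕ.≤-trans (parts≤size ν-part) (ℕ.≤-reflexive (ℕ.m≤n⇒m∸n≡0 (ℕ.<⇒≤ n<t)))))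
      size′ : sum (map suc ν) ≡ suc n
      size′ = begin
        sum (map suc ν)    ≡⟨ sum-map-suc ν ⟩
        sum ν + length ν   ≡⟨ cong₂ _+_ size len ⟩
        n ∸ t + suc t      ≡⟨ ℕ.+-suc (n ∸ t) t ⟩
        suc (n ∸ t + t)    ≡⟨ cong suc (ℕ.m∸n+n≡m t≤n) ⟩
        suc n              ∎
        where open ≡-Reasoning

  module Split {n t L} (enum : Enumerates L (IsPartitionInto (suc n) (suc t))) where

    private
      ≥2? : Decidable (All (2 ≤_))
      ≥2? = all? (2 ℕ.≤?_)

    withoutLastRow : List (List ℕ)
    withoutLastRow = map dropLast (filter (∁? ≥2?) L)

    withoutFirstColumn : List (List ℕ)
    withoutFirstColumn = map (map pred) (filter ≥2? L)

    withoutLastRow-enumerates : Enumerates withoutLastRow (IsPartitionInto n t)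
    withoutLastRow-enumerates = enumerates-map (lastRow n t) (enumerates-filter (∁? ≥2?) enum)

    withoutFirstColumn-enumerates : Enumerates withoutFirstColumn (IsPartitionInto (n ∸ t) (suc t))
    withoutFirstColumn-enumerates = enumerates-map (firstColumn n t) (enumerates-filter ≥2? enum)

    sum-split : ∀ h →
      sum (map h L) ≡ sum (map (h ∘ (_∷ʳ 1)) withoutLastRow) + sum (map (h ∘ map suc) withoutFirstColumn)
    sum-split h = trans (sum-map-filter ≥2? h L) (cong₂ _+_
      (sum-map-transport (lastRow n t) (enumerates-filter (∁? ≥2?) enum) h)
      (sum-map-transport (firstColumn n t) (enumerates-filter ≥2? enum) h))

  enumerates-0-0 : ∀ {L} → Enumerates L (IsPartitionInto 0 0) → L ≡ [ [] ]
  enumerates-0-0 (unique , mem) = enumerates-singleton (unique , λ μ → mk⇔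
    (λ μ∈L → empty (proj₂ (Equivalence.to (mem μ) μ∈L)))
    (λ { refl → Equivalence.from (mem []) (([] , [] , refl) , refl) }))
    where
    empty : ∀ {μ : List ℕ} → length μ ≡ 0 → μ ≡ []
    empty {[]} _ = refl

  enumerates-0-suc : ∀ {t L} → Enumerates L (IsPartitionInto 0 (suc t)) → L ≡ []
  enumerates-0-suc enum = enumerates-∅ enum (λ μ μ-part → ℕ.<⇒≱ (s≤s z≤n) (parts≤size μ-part))

  enumerates-suc-0 : ∀ {n L} → Enumerates L (IsPartitionInto (suc n) 0) → L ≡ []
  enumerates-suc-0 enum = enumerates-∅ enum λ { [] ((_ , _ , ()) , _) ; (_ ∷ _) (_ , ()) }

  -- partitionsInto′ f n t counts the partitions of n into t parts as soon as n ≤ f;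
  -- f only bounds the depth of the recursion.
  partitionsInto′ : ℕ → ℕ → ℕ → ℕ
  partitionsInto′ _       zero    zero    = 1
  partitionsInto′ _       zero    (suc _) = 0
  partitionsInto′ _       (suc _) zero    = 0
  partitionsInto′ zero    (suc _) (suc _) = 0
  partitionsInto′ (suc f) (suc n) (suc t) = partitionsInto′ f n t + partitionsInto′ f (n ∸ t) (suc t)

  partitionsInto : ℕ → ℕ → ℕ
  partitionsInto n t = partitionsInto′ n n t

  partitionsInto′-fuel : ∀ {f f′} n t → n ≤ f → n ≤ f′ → partitionsInto′ f n t ≡ partitionsInto′ f′ n t
  partitionsInto′-fuel zero    zero    _ _ = refl
  partitionsInto′-fuel zero    (suc t) _ _ = refl
  partitionsInto′-fuel (suc n) zero    _ _ = refl
  partitionsInto′-fuel {suc f} {suc f′} (suc n) (suc t) (s≤s n≤f) (s≤s n≤f′) =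
    cong₂ _+_ (partitionsInto′-fuel n t n≤f n≤f′)
              (partitionsInto′-fuel (n ∸ t) (suc t) (ℕ.≤-trans n∸t≤n n≤f) (ℕ.≤-trans n∸t≤n n≤f′))
    where
    n∸t≤n : n ∸ t ≤ n
    n∸t≤n = ℕ.m∸n≤m n t

  partitionsInto-suc : ∀ n t →
    partitionsInto (suc n) (suc t) ≡ partitionsInto n t + partitionsInto (n ∸ t) (suc t)
  partitionsInto-suc n t =
    cong (partitionsInto n t +_) (partitionsInto′-fuel (n ∸ t) (suc t) (ℕ.m∸n≤m n t) ℕ.≤-refl)

  length-enumeration : ∀ {n t L} → Enumerates L (IsPartitionInto n t) → length L ≡ partitionsInto n t
  length-enumeration {n} = count n ℕ.≤-refl
    where
    count : ∀ f {n t L} → n ≤ f → Enumerates L (IsPartitionInto n t) → length L ≡ partitionsInto′ f n t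
    count _       {zero}  {zero}  _ enum = cong length (enumerates-0-0 enum)
    count _       {zero}  {suc t} _ enum = cong length (enumerates-0-suc enum)
    count _       {suc n} {zero}  _ enum = cong length (enumerates-suc-0 enum)
    count (suc f) {suc n} {suc t} {L} (s≤s n≤f) enum = begin
      length L                                      ≡⟨ sum-map-const-1 L ⟨
      sum (map (λ _ → 1) L)                         ≡⟨ sum-split (λ _ → 1) ⟩
      sum (map (λ _ → 1) withoutLastRow) + sum (map (λ _ → 1) withoutFirstColumn)
        ≡⟨ cong₂ _+_ (sum-map-const-1 withoutLastRow) (sum-map-const-1 withoutFirstColumn) ⟩
      length withoutLastRow + length withoutFirstColumn
        ≡⟨ cong₂ _+_ (count f n≤f withoutLastRow-enumerates)
                     (count f (ℕ.≤-trans (ℕ.m∸n≤m n t) n≤f) withoutFirstColumn-enumerates) ⟩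
      partitionsInto′ f n t + partitionsInto′ f (n ∸ t) (suc t) ∎
      where
      open ≡-Reasoning
      open Split enum

  -- hookTotal k n t is the total number of first-column hooks of length k of the partitions of n into t parts.
  hookTotal : ℕ → ℕ → ℕ → ℕ
  hookTotal zero          _       _       = 0
  hookTotal (suc _)       zero    _       = 0
  hookTotal (suc _)       (suc _) zero    = 0
  hookTotal 1             (suc n) (suc t) = partitionsInto n t
  hookTotal (suc (suc k)) (suc n) (suc t) = hookTotal (suc k) n t + hookTotal (suc k) (n ∸ t) (suc t)

  sum-hookCount-enumeration : ∀ k {n t L} → Enumerates L (IsPartitionInto n t) →
    sum (map (hookCount (suc k)) L) ≡ hookTotal (suc k) n t
  sum-hookCount-enumeration _ {zero}  {zero}  enum rewrite enumerates-0-0 enum   = refl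
  sum-hookCount-enumeration _ {zero}  {suc t} enum rewrite enumerates-0-suc enum = refl
  sum-hookCount-enumeration _ {suc n} {zero}  enum rewrite enumerates-suc-0 enum = refl
  sum-hookCount-enumeration zero {suc n} {suc t} {L} enum = begin
    sum (map (hookCount 1) L)
      ≡⟨ sum-split (hookCount 1) ⟩
    sum (map (hookCount 1 ∘ (_∷ʳ 1)) withoutLastRow) + sum (map (hookCount 1 ∘ map suc) withoutFirstColumn)
      ≡⟨ cong₂ _+_
           (sum-map-cong-∈ (λ {ν} ν∈ → trans (hookCount-∷ʳ-1 0 ν)
                                              (cong (_+ 1) (hookCount-0 (positive withoutLastRow-enumerates ν∈)))))
           (sum-map-cong-∈ (λ {ν} ν∈ → trans (hookCount-map-suc 0 ν)
                                              (hookCount-0 (positive withoutFirstColumn-enumerates ν∈)))) ⟩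
    sum (map (λ _ → 1) withoutLastRow) + sum (map (λ _ → 0) withoutFirstColumn)
      ≡⟨ cong₂ _+_ (sum-map-const-1 withoutLastRow) (sum-map-const-0 withoutFirstColumn) ⟩
    length withoutLastRow + 0
      ≡⟨ trans (ℕ.+-identityʳ _) (length-enumeration withoutLastRow-enumerates) ⟩
    partitionsInto n t ∎
    where
    open ≡-Reasoning
    open Split enum
    positive : ∀ {m u M ν} → Enumerates M (IsPartitionInto m u) → ν ∈ M → All (1 ≤_) ν
    positive (_ , mem) ν∈ = proj₁ (proj₁ (Equivalence.to (mem _) ν∈))
    sum-map-const-0 : ∀ (xs : List (List ℕ)) → sum (map (λ _ → 0) xs) ≡ 0
    sum-map-const-0 []       = refl
    sum-map-const-0 (_ ∷ xs) = sum-map-const-0 xs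
  sum-hookCount-enumeration (suc k) {suc n} {suc t} {L} enum = begin
    sum (map (hookCount (2 + k)) L)
      ≡⟨ sum-split (hookCount (2 + k)) ⟩
    sum (map (hookCount (2 + k) ∘ (_∷ʳ 1)) withoutLastRow) + sum (map (hookCount (2 + k) ∘ map suc) withoutFirstColumn)
      ≡⟨ cong₂ _+_ (cong sum (map-cong (λ ν → trans (hookCount-∷ʳ-1 (suc k) ν) (ℕ.+-identityʳ _)) withoutLastRow))
                   (cong sum (map-cong (hookCount-map-suc (suc k)) withoutFirstColumn)) ⟩
    sum (map (hookCount (suc k)) withoutLastRow) + sum (map (hookCount (suc k)) withoutFirstColumn)
      ≡⟨ cong₂ _+_ (sum-hookCount-enumeration k withoutLastRow-enumerates)
                   (sum-hookCount-enumeration k withoutFirstColumn-enumerates) ⟩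
    hookTotal (suc k) n t + hookTotal (suc k) (n ∸ t) (suc t) ∎
    where
    open ≡-Reasoning
    open Split enum

  partitionsInto-< : ∀ {n t} → n < t → partitionsInto n t ≡ 0
  partitionsInto-< {n} = vanish n
    where
    vanish : ∀ f {n t} → n < t → partitionsInto′ f n t ≡ 0
    vanish _       {zero}  {suc _} _         = refl
    vanish zero    {suc _} {suc _} _         = refl
    vanish (suc f) {suc n} {suc t} (s≤s n<t) =
      cong₂ _+_ (vanish f n<t) (vanish f (ℕ.≤-<-trans (ℕ.m∸n≤m n t) (ℕ.m<n⇒m<1+n n<t)))

  hookTotal-< : ∀ k {n t} → n < t → hookTotal k n t ≡ 0
  hookTotal-< zero          _                         = refl
  hookTotal-< (suc _)       {zero}  _                 = refl
  hookTotal-< 1             {suc n} {suc t} (s≤s n<t) = partitionsInto-< n<t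
  hookTotal-< (suc (suc k)) {suc n} {suc t} (s≤s n<t) =
    cong₂ _+_ (hookTotal-< (suc k) n<t) (hookTotal-< (suc k) (ℕ.≤-<-trans (ℕ.m∸n≤m n t) (ℕ.m<n⇒m<1+n n<t)))

  hookTotal-short : ∀ {k n} t → n < k → hookTotal k n t ≡ 0
  hookTotal-short {suc _}       {zero}  _       _         = refl
  hookTotal-short {suc _}       {suc _} zero    _         = refl
  hookTotal-short {suc (suc k)} {suc n} (suc t) (s≤s n<k) =
    cong₂ _+_ (hookTotal-short t n<k) (hookTotal-short (suc t) (ℕ.≤-<-trans (ℕ.m∸n≤m n t) n<k))

  hookTotal-no-parts : ∀ k n → hookTotal k n 0 ≡ 0
  hookTotal-no-parts zero    _       = refl
  hookTotal-no-parts (suc _) zero    = refl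
  hookTotal-no-parts (suc _) (suc _) = refl

  m+n≡o+p⇒m≡o∸n+p : ∀ {m n o p} → m + n ≡ o + p → n ≤ o → m ≡ o ∸ n + p
  m+n≡o+p⇒m≡o∸n+p {m} {n} {o} {p} eq n≤o = ℕ.+-cancelʳ-≡ n m (o ∸ n + p) (begin
    m + n              ≡⟨ eq ⟩
    o + p              ≡⟨ cong (_+ p) (ℕ.m∸n+n≡m n≤o) ⟨
    o ∸ n + n + p      ≡⟨ ℕ.+-assoc (o ∸ n) n p ⟩
    o ∸ n + (n + p)    ≡⟨ cong (o ∸ n +_) (ℕ.+-comm n p) ⟩
    o ∸ n + (p + n)    ≡⟨ ℕ.+-assoc (o ∸ n) p n ⟨
    o ∸ n + p + n      ∎)
    where open ≡-Reasoning

  +-suc-injective : ∀ {m n o p} → suc m + suc n ≡ suc o + suc p → m + n ≡ o + p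
  +-suc-injective {m} {n} {o} {p} eq =
    ℕ.suc-injective (trans (sym (ℕ.+-suc m n)) (trans (ℕ.suc-injective eq) (ℕ.+-suc o p)))

  complement-vanishing : ∀ k {N u M} → N < suc k → M < u →
    hookTotal (suc k) N (suc u) + hookTotal (suc k) M u ≡ partitionsInto M u
  complement-vanishing k N<k+1 M<u =
    trans (cong₂ _+_ (hookTotal-short _ N<k+1) (hookTotal-< (suc k) M<u)) (sym (partitionsInto-< M<u))

  hookTotal-complement : ∀ k {N u M} → N + u ≡ M + suc k →
    hookTotal (suc k) N (suc u) + hookTotal (suc k) M u ≡ partitionsInto M u
  hookTotal-complement-≤ : ∀ k {N u M} → u ≤ M → N + u ≡ M + suc k →
    hookTotal (suc k) N (suc u) + hookTotal (suc k) M u ≡ partitionsInto M u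

  hookTotal-complement k {N} {u} {M} eq with M ℕ.<? u
  ... | no M≮u  = hookTotal-complement-≤ k (ℕ.≮⇒≥ M≮u) eq
  ... | yes M<u = complement-vanishing k (ℕ.+-cancelʳ-< u N (suc k) (begin-strict
    N + u        ≡⟨ eq ⟩
    M + suc k    <⟨ ℕ.+-monoˡ-< (suc k) M<u ⟩
    u + suc k    ≡⟨ ℕ.+-comm u (suc k) ⟩
    suc k + u    ∎)) M<u
    where open ℕ.≤-Reasoning

  hookTotal-complement-≤ k {zero} {u} {M} u≤M eq =
    ⊥-elim (ℕ.<⇒≱ (subst (M <_) (sym eq) (ℕ.m<m+n M (s≤s z≤n))) u≤M)
  hookTotal-complement-≤ _ {suc _} {suc _} {zero} () _
  hookTotal-complement-≤ zero {suc N} {zero} {M} _ eq =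
    trans (cong₂ _+_ (cong (λ m → partitionsInto m 0) N≡M) (hookTotal-no-parts 1 M)) (ℕ.+-identityʳ _)
    where
    N≡M : N ≡ M
    N≡M = trans (sym (ℕ.+-identityʳ N)) (ℕ.suc-injective (trans eq (ℕ.+-comm M 1)))
  hookTotal-complement-≤ (suc k) {suc N} {zero} {M} _ eq = begin
    hookTotal (suc k) N 0 + hookTotal (suc k) N 1 + hookTotal (2 + k) M 0
      ≡⟨ cong₂ _+_ (cong (_+ hookTotal (suc k) N 1) (hookTotal-no-parts (suc k) N))
                   (trans (hookTotal-no-parts (2 + k) M) (sym (hookTotal-no-parts (suc k) M))) ⟩
    hookTotal (suc k) N 1 + hookTotal (suc k) M 0
      ≡⟨ hookTotal-complement k (ℕ.suc-injective (trans eq (ℕ.+-suc M (suc k)))) ⟩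
    partitionsInto M 0 ∎
    where open ≡-Reasoning
  hookTotal-complement-≤ zero {suc N} {suc u} {suc M} (s≤s u≤M) eq = begin
    partitionsInto N (suc u) + partitionsInto M u
      ≡⟨ ℕ.+-comm (partitionsInto N (suc u)) _ ⟩
    partitionsInto M u + partitionsInto N (suc u)
      ≡⟨ cong (λ m → partitionsInto M u + partitionsInto m (suc u)) N≡M∸u ⟩
    partitionsInto M u + partitionsInto (M ∸ u) (suc u)
      ≡⟨ partitionsInto-suc M u ⟨
    partitionsInto (suc M) (suc u) ∎
    where
    open ≡-Reasoning
    N≡M∸u : N ≡ M ∸ u
    N≡M∸u = trans (m+n≡o+p⇒m≡o∸n+p (+-suc-injective eq) u≤M) (ℕ.+-identityʳ (M ∸ u))
  hookTotal-complement-≤ (suc k) {suc N} {suc u} {suc M} (s≤s u≤M) eq = begin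
    (hook N (suc u) + hook (N ∸ suc u) (2 + u)) + (hook M u + hook (M ∸ u) (suc u))
      ≡⟨ interchange (hook N (suc u)) _ _ _ ⟩
    (hook N (suc u) + hook M u) + (hook (N ∸ suc u) (2 + u) + hook (M ∸ u) (suc u))
      ≡⟨ cong₂ _+_ (hookTotal-complement k eq′) first-column-removed ⟩
    partitionsInto M u + partitionsInto (M ∸ u) (suc u)
      ≡⟨ partitionsInto-suc M u ⟨
    partitionsInto (suc M) (suc u) ∎
    where
    open ≡-Reasoning
    hook : ℕ → ℕ → ℕ
    hook = hookTotal (suc k)
    eq′ : N + u ≡ M + suc k
    eq′ = +-suc-injective eq
    N≡ : N ≡ M ∸ u + suc k
    N≡ = m+n≡o+p⇒m≡o∸n+p eq′ u≤M
    first-column-removed : hook (N ∸ suc u) (2 + u) + hook (M ∸ u) (suc u) ≡ partitionsInto (M ∸ u) (suc u)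
    first-column-removed with suc u ℕ.≤? N
    ... | yes u<N = hookTotal-complement k (trans (ℕ.m∸n+n≡m u<N) N≡)
    ... | no u≮N  = complement-vanishing k
      (subst (_< suc k) (sym (ℕ.m≤n⇒m∸n≡0 (ℕ.<⇒≤ N<1+u))) (s≤s z≤n))
      (ℕ.≤-<-trans (ℕ.≤-trans (ℕ.m≤m+n (M ∸ u) (suc k)) (ℕ.≤-reflexive (sym N≡))) N<1+u)
      where
      N<1+u : N < suc u
      N<1+u = ℕ.≰⇒> u≮N

open PowerSeries
open Partitions
open import Data.Nat as ℕ using (ℕ; zero; suc; _∸_; _≤_; _<_; z≤n; s≤s)
import Data.Nat.Properties as ℕ
open import Data.Integer using (ℤ; +_; -_; _+_; _*_; _-_)
open import Data.Integer.Properties using (pos-+; +-identityʳ; +-identityˡ; +-inverseʳ; +-assoc; +-comm; *-identityˡ)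
open import Data.List using (List; []; _∷_; map; filter; length; upTo; applyUpTo)
open import Data.List.Properties using (filter-accept; filter-reject; map-∘; map-upTo)
open import Data.List.Relation.Unary.All as All using (All; []; _∷_)
open import Data.List.Relation.Unary.Unique.Propositional using (Unique)
open import Data.List.Membership.Propositional using (_∈_)
open import Data.Nat.ListAction using (sum)
open import Function.Bundles using (_⇔_; Equivalence)

m+n-n≡m : ∀ m n → m + n - n ≡ m
m+n-n≡m m n = trans (+-assoc m n (- n)) (trans (cong (_+_ m) (+-inverseʳ n)) (+-identityʳ m))

m+n≡o+p⇒m≡o+[p-n] : ∀ {m n o p} → m + n ≡ o + p → m ≡ o + (p - n)
m+n≡o+p⇒m≡o+[p-n] {m} {n} {o} {p} eq =
  trans (sym (m+n-n≡m m n)) (trans (cong (_- n) eq) (+-assoc o p (- n)))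

sum-by-length : ∀ (f : List ℕ → ℕ) n L → All (λ μ → length μ ≤ n) L →
  + sum (map f L) ≡ sumTo n (λ t → + sum (map f (filter (λ μ → length μ ℕ.≟ t) L)))
sum-by-length f n []      _             = sym (sumTo-zero n (λ _ _ → refl))
sum-by-length f n (μ ∷ L) (len≤n ∷ L≤n) = begin
  + (f μ ℕ.+ sum (map f L))
    ≡⟨ pos-+ (f μ) (sum (map f L)) ⟩
  + f μ + + sum (map f L)
    ≡⟨ cong₂ _+_ (sym (sumTo-monoS n (λ _ → + f μ) len≤n)) (sum-by-length f n L L≤n) ⟩
  sumTo n (λ t → monoS (length μ) t * + f μ) + sumTo n (λ t → + sum (map f (ofLength t L)))
    ≡⟨ sumTo-distrib-+ n _ _ ⟨
  sumTo n (λ t → monoS (length μ) t * + f μ + + sum (map f (ofLength t L)))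
    ≡⟨ sumTo-cong n (λ t _ → sym (cons t)) ⟩
  sumTo n (λ t → + sum (map f (ofLength t (μ ∷ L)))) ∎
  where
  open ≡-Reasoning
  ofLength : ℕ → List (List ℕ) → List (List ℕ)
  ofLength t = filter (λ ν → length ν ℕ.≟ t)
  cons : ∀ t → + sum (map f (ofLength t (μ ∷ L))) ≡ monoS (length μ) t * + f μ + + sum (map f (ofLength t L))
  cons t with length μ ℕ.≟ t
  ... | yes refl = trans (cong (λ ν → + sum (map f ν)) (filter-accept (λ ν → length ν ℕ.≟ t) {μ} {L} refl))
    (trans (pos-+ (f μ) _) (cong (_+ + sum (map f (ofLength t L))) (sym (*-identityˡ (+ f μ)))))
  ... | no len≢t = trans (cong (λ ν → + sum (map f ν)) (filter-reject (λ ν → length ν ℕ.≟ t) {μ} {L} len≢t))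
    (sym (+-identityˡ _))

partitionSeries : Series
partitionSeries n = sumTo n (λ t → + partitionsInto n t)

hookSeries : ℕ → Series
hookSeries k n = sumTo n (λ t → + hookTotal k n t)

sum-hookCount : ∀ k {n L} → Enumerates L (IsPartition n) →
  + sum (map (hookCount (suc k)) L) ≡ hookSeries (suc k) n
sum-hookCount k {n} {L} enum@(_ , mem) = begin
  + sum (map (hookCount (suc k)) L)
    ≡⟨ sum-by-length (hookCount (suc k)) n L (All.tabulate (λ {μ} μ∈L →
         parts≤size (Equivalence.to (mem μ) μ∈L , refl))) ⟩
  sumTo n (λ t → + sum (map (hookCount (suc k)) (filter (λ μ → length μ ℕ.≟ t) L)))
    ≡⟨ sumTo-cong n (λ t _ → cong +_
         (sum-hookCount-enumeration k (enumerates-filter (λ μ → length μ ℕ.≟ t) enum))) ⟩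
  hookSeries (suc k) n ∎
  where open ≡-Reasoning

hookSeries-short : ∀ {k n} → n < k → hookSeries k n ≡ + 0
hookSeries-short {n = n} n<k = sumTo-zero n (λ t _ → cong +_ (hookTotal-short t n<k))

hookSeries-1 : ∀ m → hookSeries 1 (suc m) ≡ partitionSeries m
hookSeries-1 m = trans (sumTo-suc m _) (+-identityˡ _)

hookSeries-suc : ∀ k m → hookSeries (2 ℕ.+ k) (suc (suc k ℕ.+ m)) + hookSeries (suc k) m
                          ≡ partitionSeries m + hookSeries (suc k) (suc k ℕ.+ m)
hookSeries-suc k m = begin
  hookSeries (2 ℕ.+ k) (suc n) + hookSeries (suc k) m
    ≡⟨ cong (_+ hookSeries (suc k) m) (trans (sumTo-suc n _) (+-identityˡ (sumTo n (λ t → + hook₊ (suc n) (suc t))))) ⟩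
  sumTo n (λ t → + (hook n t ℕ.+ hook (n ∸ t) (suc t))) + hookSeries (suc k) m
    ≡⟨ cong (_+ hookSeries (suc k) m) (trans (sumTo-cong n (λ t _ → pos-+ (hook n t) _)) (sumTo-distrib-+ n _ _)) ⟩
  hookSeries (suc k) n + withoutFirstColumn + hookSeries (suc k) m
    ≡⟨ +-assoc (hookSeries (suc k) n) withoutFirstColumn (hookSeries (suc k) m) ⟩
  hookSeries (suc k) n + (withoutFirstColumn + hookSeries (suc k) m)
    ≡⟨ cong (_+_ (hookSeries (suc k) n)) complement ⟩
  hookSeries (suc k) n + partitionSeries m
    ≡⟨ +-comm (hookSeries (suc k) n) (partitionSeries m) ⟩
  partitionSeries m + hookSeries (suc k) n ∎
  where
  open ≡-Reasoning
  hook hook₊ : ℕ → ℕ → ℕ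
  hook  = hookTotal (suc k)
  hook₊ = hookTotal (2 ℕ.+ k)
  n : ℕ
  n = suc k ℕ.+ m
  m≤n : m ≤ n
  m≤n = ℕ.m≤n+m m (suc k)
  withoutFirstColumn : ℤ
  withoutFirstColumn = sumTo n (λ t → + hook (n ∸ t) (suc t))
  complement : withoutFirstColumn + hookSeries (suc k) m ≡ partitionSeries m
  complement = begin
    withoutFirstColumn + hookSeries (suc k) m
      ≡⟨ cong (_+_ withoutFirstColumn) (sumTo-extend _ m≤n (λ t m<t → cong +_ (hookTotal-< (suc k) m<t))) ⟨
    withoutFirstColumn + sumTo n (λ t → + hook m t)
      ≡⟨ sumTo-distrib-+ n _ _ ⟨
    sumTo n (λ t → + hook (n ∸ t) (suc t) + + hook m t)
      ≡⟨ sumTo-cong n (λ t t≤n → trans (sym (pos-+ (hook (n ∸ t) (suc t)) _))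
           (cong +_ (hookTotal-complement k (trans (ℕ.m∸n+n≡m t≤n) (ℕ.+-comm (suc k) m))))) ⟩
    sumTo n (λ t → + partitionsInto m t)
      ≡⟨ sumTo-extend _ m≤n (λ t m<t → cong +_ (partitionsInto-< m<t)) ⟩
    partitionSeries m ∎

atMostParts : ℕ → Series
atMostParts b n = sumTo b (λ t → + partitionsInto n t)

partitionsInto≡atMostParts : ∀ s m → + partitionsInto (s ℕ.+ m) s ≡ atMostParts s m
partitionsInto≡atMostParts zero    m = refl
partitionsInto≡atMostParts (suc s) m = begin
  + partitionsInto (suc s ℕ.+ m) (suc s)
    ≡⟨ cong +_ (partitionsInto-suc (s ℕ.+ m) s) ⟩
  + (partitionsInto (s ℕ.+ m) s ℕ.+ partitionsInto (s ℕ.+ m ∸ s) (suc s))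
    ≡⟨ pos-+ (partitionsInto (s ℕ.+ m) s) _ ⟩
  + partitionsInto (s ℕ.+ m) s + + partitionsInto (s ℕ.+ m ∸ s) (suc s)
    ≡⟨ cong₂ _+_ (partitionsInto≡atMostParts s m) (cong (λ x → + partitionsInto x (suc s)) (ℕ.m+n∸m≡n s m)) ⟩
  atMostParts (suc s) m ∎
  where open ≡-Reasoning

monoS-atMostParts : ∀ b → mulS (monoS (suc b)) (atMostParts (suc b)) ≗ λ n → + partitionsInto n (suc b)
monoS-atMostParts b = mulS-monoS (suc b) (λ m → sym (partitionsInto≡atMostParts (suc b) m))
                                         (λ n n<b+1 → cong +_ (partitionsInto-< n<b+1))

oneMinus-atMostParts : ∀ b → mulS (oneMinus (suc b)) (atMostParts (suc b)) ≗ atMostParts b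
oneMinus-atMostParts b n = begin
  mulS (oneMinus (suc b)) (atMostParts (suc b)) n
    ≡⟨ mulS-oneMinus (suc b) (atMostParts (suc b)) n ⟩
  atMostParts (suc b) n - mulS (monoS (suc b)) (atMostParts (suc b)) n
    ≡⟨ cong (_-_ (atMostParts (suc b) n)) (monoS-atMostParts b n) ⟩
  atMostParts b n + + partitionsInto n (suc b) - + partitionsInto n (suc b)
    ≡⟨ m+n-n≡m (atMostParts b n) (+ partitionsInto n (suc b)) ⟩
  atMostParts b n ∎
  where open ≡-Reasoning

qPoch-atMostParts : ∀ b → mulS (qPoch b) (atMostParts b) ≗ oneS
qPoch-atMostParts zero n = trans (mulS-identityˡ (atMostParts 0) n) (atMostParts-0 n)
  where
  atMostParts-0 : atMostParts 0 ≗ oneS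
  atMostParts-0 zero    = refl
  atMostParts-0 (suc _) = refl
qPoch-atMostParts (suc b) = begin
  mulS (qPoch (suc b)) (atMostParts (suc b))
    ≈⟨ mulS-congˡ (atMostParts (suc b)) (qPoch-suc b) ⟩
  mulS (mulS (qPoch b) (oneMinus (suc b))) (atMostParts (suc b))
    ≈⟨ mulS-assoc (qPoch b) (oneMinus (suc b)) (atMostParts (suc b)) ⟩
  mulS (qPoch b) (mulS (oneMinus (suc b)) (atMostParts (suc b)))
    ≈⟨ mulS-congʳ (qPoch b) (oneMinus-atMostParts b) ⟩
  mulS (qPoch b) (atMostParts b)
    ≈⟨ qPoch-atMostParts b ⟩
  oneS ∎
  where open ≗-Reasoning

invS-qPochInf-1≗partitionSeries : invS (qPochInf 1) ≗ partitionSeries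
invS-qPochInf-1≗partitionSeries = invS-unique (qPochInf 1) partitionSeries (qPochInf-0 1 (s≤s z≤n)) λ n → trans
  (mulS-cong-≤ n (λ i i≤n → qPochInf≡pochhammer 1 (suc n) i (s≤s (ℕ.m≤n⇒m≤1+n i≤n)))
                 (λ i i≤n → sym (sumTo-extend _ (ℕ.m≤n⇒m≤1+n i≤n) (λ t i<t → cong +_ (partitionsInto-< i<t)))))
  (qPoch-atMostParts (suc n) n)

invS-qPochInf-suc : ∀ k → 1 ≤ k → invS (qPochInf (suc k)) ≗ mulS (oneMinus k) (invS (qPochInf k))
invS-qPochInf-suc k 1≤k = invS-unique (qPochInf (suc k)) (mulS (oneMinus k) Iₖ) (qPochInf-0 (suc k) (s≤s z≤n)) (begin
  mulS (qPochInf (suc k)) (mulS (oneMinus k) Iₖ)   ≈⟨ mulS-x∙yz≈yx∙z (qPochInf (suc k)) (oneMinus k) Iₖ ⟩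
  mulS (mulS (oneMinus k) (qPochInf (suc k))) Iₖ   ≈⟨ mulS-congˡ Iₖ (qPochInf-suc k) ⟨
  mulS (qPochInf k) Iₖ                             ≈⟨ invS-inverseʳ (qPochInf k) (qPochInf-0 k 1≤k) ⟩
  oneS                                             ∎)
  where
  open ≗-Reasoning
  Iₖ : Series
  Iₖ = invS (qPochInf k)

invS-qPochInf-1-split : ∀ k → invS (qPochInf 1) ≗ mulS (invS (qPochInf (suc k))) (invS (qPoch k))
invS-qPochInf-1-split k = begin
  invS (qPochInf 1)                                  ≈⟨ invS-cong (qPochInf-1 k) ⟩
  invS (mulS (qPoch k) (qPochInf (suc k)))
    ≈⟨ invS-mulS (qPoch k) (qPochInf (suc k)) (qPoch-0 k) (qPochInf-0 (suc k) (s≤s z≤n)) ⟩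
  mulS (invS (qPoch k)) (invS (qPochInf (suc k)))    ≈⟨ mulS-comm (invS (qPoch k)) (invS (qPochInf (suc k))) ⟩
  mulS (invS (qPochInf (suc k))) (invS (qPoch k))    ∎
  where open ≗-Reasoning

inverseQPochSum : ℕ → Series
inverseQPochSum k = sumS (map (λ l → invS (qPoch (k ∸ l))) (map suc (upTo k)))

inverseQPochSum-suc : ∀ k → inverseQPochSum (suc k) ≡ addS (invS (qPoch k)) (inverseQPochSum k)
inverseQPochSum-suc k = cong (addS (invS (qPoch k)) ∘ sumS)
  (trans (sym (map-∘ (applyUpTo suc k))) (cong (map (λ l → invS (qPoch (k ∸ l)))) (sym (map-upTo suc k))))

-- The series T_k; rhsSeries k is definitionally mulS (monoS k) (rhsCofactor k).
rhsCofactor : ℕ → Series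
rhsCofactor k = mulS (invS (qPochInf k)) (inverseQPochSum k)

rhsCofactor-1 : rhsCofactor 1 ≗ partitionSeries
rhsCofactor-1 m = begin
  mulS I₁ (addS (invS oneS) (λ _ → + 0)) m
    ≡⟨ mulS-distribˡ-addS I₁ (invS oneS) (λ _ → + 0) m ⟩
  mulS I₁ (invS oneS) m + mulS I₁ (λ _ → + 0) m
    ≡⟨ cong₂ _+_ (sym (invS-qPochInf-1-split 0 m)) (mulS-zeroʳ I₁ m) ⟩
  I₁ m + + 0
    ≡⟨ trans (+-identityʳ (I₁ m)) (invS-qPochInf-1≗partitionSeries m) ⟩
  partitionSeries m ∎
  where
  open ≡-Reasoning
  I₁ : Series
  I₁ = invS (qPochInf 1)

rhsCofactor-suc : ∀ k → 1 ≤ k → ∀ m →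
  rhsCofactor (suc k) m ≡ partitionSeries m + (rhsCofactor k m - mulS (monoS k) (rhsCofactor k) m)
rhsCofactor-suc k 1≤k m = begin
  mulS Iₖ₊₁ (inverseQPochSum (suc k)) m
    ≡⟨ cong (λ s → mulS Iₖ₊₁ s m) (inverseQPochSum-suc k) ⟩
  mulS Iₖ₊₁ (addS (invS (qPoch k)) (inverseQPochSum k)) m
    ≡⟨ mulS-distribˡ-addS Iₖ₊₁ (invS (qPoch k)) (inverseQPochSum k) m ⟩
  mulS Iₖ₊₁ (invS (qPoch k)) m + mulS Iₖ₊₁ (inverseQPochSum k) m
    ≡⟨ cong₂ _+_ (trans (sym (invS-qPochInf-1-split k m)) (invS-qPochInf-1≗partitionSeries m))
                 (mulS-congˡ (inverseQPochSum k) (invS-qPochInf-suc k 1≤k) m) ⟩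
  partitionSeries m + mulS (mulS (oneMinus k) (invS (qPochInf k))) (inverseQPochSum k) m
    ≡⟨ cong (_+_ (partitionSeries m)) (trans (mulS-assoc (oneMinus k) (invS (qPochInf k)) (inverseQPochSum k) m)
                                              (mulS-oneMinus k (rhsCofactor k) m)) ⟩
  partitionSeries m + (rhsCofactor k m - mulS (monoS k) (rhsCofactor k) m) ∎
  where
  open ≡-Reasoning
  Iₖ₊₁ : Series
  Iₖ₊₁ = invS (qPochInf (suc k))

rhsCofactor≡hookSeries : ∀ k m → rhsCofactor (suc k) m ≡ hookSeries (suc k) (suc k ℕ.+ m)
rhsSeries≗hookSeries : ∀ k → rhsSeries (suc k) ≗ hookSeries (suc k)

rhsCofactor≡hookSeries zero    m = trans (rhsCofactor-1 m) (sym (hookSeries-1 m))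
rhsCofactor≡hookSeries (suc k) m = begin
  rhsCofactor (2 ℕ.+ k) m
    ≡⟨ rhsCofactor-suc (suc k) (s≤s z≤n) m ⟩
  partitionSeries m + (rhsCofactor (suc k) m - mulS (monoS (suc k)) (rhsCofactor (suc k)) m)
    ≡⟨ cong₂ (λ a b → partitionSeries m + (a - b)) (rhsCofactor≡hookSeries k m) (rhsSeries≗hookSeries k m) ⟩
  partitionSeries m + (hookSeries (suc k) (suc k ℕ.+ m) - hookSeries (suc k) m)
    ≡⟨ m+n≡o+p⇒m≡o+[p-n] {o = partitionSeries m} {p = hookSeries (suc k) (suc k ℕ.+ m)} (hookSeries-suc k m) ⟨
  hookSeries (2 ℕ.+ k) (2 ℕ.+ k ℕ.+ m) ∎
  where open ≡-Reasoning

rhsSeries≗hookSeries k = mulS-monoS (suc k) (rhsCofactor≡hookSeries k) (λ _ → hookSeries-short)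

mainTheorem8 : (k : ℕ) → 1 ≤ k → (n : ℕ) (L : List (List ℕ)) → Unique L →
    ((μ : List ℕ) → (μ ∈ L) ⇔ IsPartition n μ) →
    + sum (map (hookCount k) L) ≡ rhsSeries k n
mainTheorem8 (suc k) _ n L unique mem = trans (sum-hookCount k (unique , mem)) (sym (rhsSeries≗hookSeries k n))
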